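{- If $N$ and $M$ are Nov\'ak numbers, then $\gcd(N,M)$ and $\operatorname{lcm}(N,M)$ are Nov\'ak numbers.
   Context: A Nov\'ak number is a positive integer $N$ with $N\mid 2^N+1$. -}

module Defs where

open import Data.Nat using (ℕ; _+_; _^_; _<_)
open import Data.Nat.Divisibility using (_∣_)
open import Data.Product using (_×_)

IsNovak : ℕ → Set
IsNovak N = (0 < N) × (N ∣ 2 ^ N + 1)

-- Novák numbers are odd, so modulo a divisor d of 2^N + 1 we have 2^N ≡ -1, and hence
-- 2^(qN) ≡ (-1)^q = -1 for every odd q.  For the lcm L of N and M, L is odd and L/N, L/M
-- are odd, so N and M both divide 2^L + 1.  For the gcd g, Bézout gives g + yM = xN with
-- x + y odd (compare parities); modulo g this reads 2^g (-1)^y ≡ (-1)^x, i.e.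
-- 2^g ≡ (-1)^(x+y) = -1.
module Submission where

open import Defs
open import Data.Nat using (ℕ)
open import Data.Nat.GCD using (gcd)
open import Data.Nat.LCM using (lcm)
open import Data.Product using (_×_)

open import Data.Nat.Base using (zero; suc; _+_; _*_; _^_; _<_; z<s; parity)
import Data.Nat.Properties as ℕP
open import Data.Nat.Divisibility using (_∣_; divides; ∣-trans; m∣m*n; n∣m*n)
open import Data.Nat.GCD using (gcd[m,n]∣m; gcd[m,n]∣n; gcd-GCD; module Bézout)
open import Data.Nat.LCM using (lcm-least; m∣lcm[m,n]; n∣lcm[m,n])
open import Data.Parity.Base as ℙ using (0ℙ; 1ℙ)
import Data.Parity.Properties as ℙP
open import Data.Integer.Base as ℤ using (ℤ; +_; 1ℤ; -1ℤ)
import Data.Integer.Properties as ℤP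
import Data.Integer.Divisibility.Signed as ℤD
open import Data.Integer.Tactic.RingSolver using (solve-∀)
open import Data.Product using (_,_; proj₁; proj₂)
open import Level using (0ℓ)
open import Relation.Binary.Bundles using (Setoid)
open import Relation.Binary.PropositionalEquality
  using (_≡_; refl; sym; trans; cong; cong₂; subst; module ≡-Reasoning)

private
  variable
    a d l m n N : ℕ
    i j k : ℤ

Odd : ℕ → Set
Odd n = parity n ≡ 1ℙ

p*q≡1ℙ⇒p≡1ℙ×q≡1ℙ : ∀ p q → p ℙ.* q ≡ 1ℙ → p ≡ 1ℙ × q ≡ 1ℙ
p*q≡1ℙ⇒p≡1ℙ×q≡1ℙ 1ℙ 1ℙ refl = refl , refl

odd-* : Odd m → Odd n → Odd (m * n)
odd-* {m} {n} oddM oddN = trans (ℙP.*-homo-* m n) (cong₂ ℙ._*_ oddM oddN)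

odd-*⇒oddˡ : ∀ m n → Odd (m * n) → Odd m
odd-*⇒oddˡ m n odd = proj₁ (p*q≡1ℙ⇒p≡1ℙ×q≡1ℙ _ _ (trans (sym (ℙP.*-homo-* m n)) odd))

odd-*⇒oddʳ : ∀ m n → Odd (m * n) → Odd n
odd-*⇒oddʳ m n odd = proj₂ (p*q≡1ℙ⇒p≡1ℙ×q≡1ℙ _ _ (trans (sym (ℙP.*-homo-* m n)) odd))

odd-∣ : d ∣ n → Odd n → Odd d
odd-∣ (divides q refl) = odd-*⇒oddʳ q _

parity-*-odd : ∀ m → Odd n → parity (m * n) ≡ parity m
parity-*-odd {n} m oddN =
  trans (ℙP.*-homo-* m n) (trans (cong (parity m ℙ.*_) oddN) (ℙP.*-identityʳ (parity m)))

odd⇒positive : Odd n → 0 < n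
odd⇒positive {suc n} _ = z<s

odd-2^[1+n]+1 : ∀ n → Odd (2 ^ suc n + 1)
odd-2^[1+n]+1 n = trans (ℙP.+-homo-+ (2 ^ suc n) 1) (cong (ℙ._+ 1ℙ) (ℙP.*-homo-* 2 (2 ^ n)))

novak⇒odd : IsNovak N → Odd N
novak⇒odd {suc n} (_ , N∣2^N+1) = odd-∣ N∣2^N+1 (odd-2^[1+n]+1 n)

-1^[2+n]≡-1^n : ∀ n → -1ℤ ℤ.^ (2 + n) ≡ -1ℤ ℤ.^ n
-1^[2+n]≡-1^n n = trans (ℤP.^-distribˡ-+-* -1ℤ 2 n) (ℤP.*-identityˡ (-1ℤ ℤ.^ n))

-1^even≡1 : ∀ n → parity n ≡ 0ℙ → -1ℤ ℤ.^ n ≡ 1ℤ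
-1^even≡1 zero          _    = refl
-1^even≡1 (suc (suc n)) even = trans (-1^[2+n]≡-1^n n) (-1^even≡1 n even)

-1^odd≡-1 : ∀ n → Odd n → -1ℤ ℤ.^ n ≡ -1ℤ
-1^odd≡-1 (suc zero)    _   = refl
-1^odd≡-1 (suc (suc n)) odd = trans (-1^[2+n]≡-1^n n) (-1^odd≡-1 n odd)

-1^[n+n]≡1 : ∀ n → -1ℤ ℤ.^ (n + n) ≡ 1ℤ
-1^[n+n]≡1 n = -1^even≡1 (n + n) (trans (ℙP.+-homo-+ n n) (ℙP.p+p≡0ℙ (parity n)))

infix 4 _≡_mod_

data _≡_mod_ (i j : ℤ) (m : ℕ) : Set where
  congruent : + m ℤD.∣ i ℤ.- j → i ≡ j mod m

≡-mod-refl : i ≡ i mod m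
≡-mod-refl {i} = congruent (ℤD.divides (+ 0) (ℤP.+-inverseʳ i))

≡-mod-reflexive : i ≡ j → i ≡ j mod m
≡-mod-reflexive refl = ≡-mod-refl

≡-mod-sym : i ≡ j mod m → j ≡ i mod m
≡-mod-sym {i} {j} {m} (congruent m∣i-j) = congruent (subst (+ m ℤD.∣_) (-[i-j]≡j-i i j) (ℤD.∣m⇒∣-m m∣i-j))
  where
  -[i-j]≡j-i : ∀ i j → ℤ.- (i ℤ.- j) ≡ j ℤ.- i
  -[i-j]≡j-i = solve-∀

≡-mod-trans : i ≡ j mod m → j ≡ k mod m → i ≡ k mod m
≡-mod-trans {i} {j} {m} {k} (congruent m∣i-j) (congruent m∣j-k) =
  congruent (subst (+ m ℤD.∣_) (i-j+j-k≡i-k i j k) (ℤD.∣m∣n⇒∣m+n m∣i-j m∣j-k))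
  where
  i-j+j-k≡i-k : ∀ i j k → (i ℤ.- j) ℤ.+ (j ℤ.- k) ≡ i ℤ.- k
  i-j+j-k≡i-k = solve-∀

≡-mod-setoid : ℕ → Setoid 0ℓ 0ℓ
≡-mod-setoid m = record
  { Carrier       = ℤ
  ; _≈_           = _≡_mod m
  ; isEquivalence = record
    { refl  = ≡-mod-refl
    ; sym   = ≡-mod-sym
    ; trans = ≡-mod-trans
    }
  }

*-cong-mod : ∀ {i j k l} → i ≡ j mod m → k ≡ l mod m → i ℤ.* k ≡ j ℤ.* l mod m
*-cong-mod {m} {i} {j} {k} {l} (congruent m∣i-j) (congruent m∣k-l) =
  congruent (subst (+ m ℤD.∣_) (expand i j k l) (ℤD.∣m∣n⇒∣m+n (ℤD.∣m⇒∣m*n k m∣i-j) (ℤD.∣n⇒∣m*n j m∣k-l)))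
  where
  expand : ∀ i j k l → (i ℤ.- j) ℤ.* k ℤ.+ j ℤ.* (k ℤ.- l) ≡ i ℤ.* k ℤ.- j ℤ.* l
  expand = solve-∀

*-congˡ-mod : ∀ i → j ≡ k mod m → i ℤ.* j ≡ i ℤ.* k mod m
*-congˡ-mod i j≡k = *-cong-mod (≡-mod-refl {i}) j≡k

*-congʳ-mod : ∀ k → i ≡ j mod m → i ℤ.* k ≡ j ℤ.* k mod m
*-congʳ-mod k i≡j = *-cong-mod i≡j (≡-mod-refl {k})

^-cong-mod : i ≡ j mod m → ∀ n → i ℤ.^ n ≡ j ℤ.^ n mod m
^-cong-mod i≡j zero    = ≡-mod-refl
^-cong-mod i≡j (suc n) = *-cong-mod i≡j (^-cong-mod i≡j n)

^-odd-≡-1 : ∀ n → i ≡ -1ℤ mod m → Odd n → i ℤ.^ n ≡ -1ℤ mod m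
^-odd-≡-1 n i≡-1 oddN = ≡-mod-trans (^-cong-mod i≡-1 n) (≡-mod-reflexive (-1^odd≡-1 n oddN))

pos-^ : ∀ a n → + (a ^ n) ≡ (+ a) ℤ.^ n
pos-^ a zero    = refl
pos-^ a (suc n) = trans (ℤP.pos-* a (a ^ n)) (cong (+ a ℤ.*_) (pos-^ a n))

∣^+1⇒^≡-1 : ∀ a n → m ∣ a ^ n + 1 → (+ a) ℤ.^ n ≡ -1ℤ mod m
∣^+1⇒^≡-1 a n m∣ = subst (_≡ -1ℤ mod _) (pos-^ a n) (congruent (ℤD.∣ᵤ⇒∣ m∣))

^≡-1⇒∣^+1 : ∀ a n → (+ a) ℤ.^ n ≡ -1ℤ mod m → m ∣ a ^ n + 1
^≡-1⇒∣^+1 a n a^n≡-1 with subst (_≡ -1ℤ mod _) (sym (pos-^ a n)) a^n≡-1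
... | congruent m∣ = ℤD.∣⇒∣ᵤ m∣

∣^+1⇒∣^[odd-multiple]+1 : ∀ a n → m ∣ a ^ n + 1 → n ∣ l → Odd l → m ∣ a ^ l + 1
∣^+1⇒∣^[odd-multiple]+1 a n m∣ (divides q refl) oddL = ^≡-1⇒∣^+1 a (q * n) (begin
  (+ a) ℤ.^ (q * n)     ≡⟨ cong ((+ a) ℤ.^_) (ℕP.*-comm q n) ⟩
  (+ a) ℤ.^ (n * q)     ≡⟨ ℤP.^-*-assoc (+ a) n q ⟨
  ((+ a) ℤ.^ n) ℤ.^ q   ≈⟨ ^-odd-≡-1 q (∣^+1⇒^≡-1 a n m∣) (odd-*⇒oddˡ q n oddL) ⟩
  -1ℤ                   ∎)
  where open import Relation.Binary.Reasoning.Setoid (≡-mod-setoid _)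

bezout-parity : ∀ g M N x y → Odd g → Odd N → Odd M → g + y * M ≡ x * N → Odd (x + y)
bezout-parity g M N x y oddG oddN oddM eq = begin
  parity (x + y)                   ≡⟨ ℙP.+-homo-+ x y ⟩
  parity x ℙ.+ parity y            ≡⟨ cong (ℙ._+ parity y) px≡1+py ⟩
  1ℙ ℙ.+ parity y ℙ.+ parity y     ≡⟨ ℙP.+-assoc 1ℙ (parity y) (parity y) ⟩
  1ℙ ℙ.+ (parity y ℙ.+ parity y)   ≡⟨ cong (1ℙ ℙ.+_) (ℙP.p+p≡0ℙ (parity y)) ⟩
  1ℙ                               ∎
  where
  open ≡-Reasoning
  px≡1+py : parity x ≡ 1ℙ ℙ.+ parity y
  px≡1+py = begin
    parity x                        ≡⟨ parity-*-odd x oddN ⟨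
    parity (x * N)                  ≡⟨ cong parity eq ⟨
    parity (g + y * M)              ≡⟨ ℙP.+-homo-+ g (y * M) ⟩
    parity g ℙ.+ parity (y * M)     ≡⟨ cong₂ ℙ._+_ oddG (parity-*-odd y oddM) ⟩
    1ℙ ℙ.+ parity y                 ∎

^-bezout : ∀ i g M N x y → g + y * M ≡ x * N → i ℤ.^ g ℤ.* (i ℤ.^ M) ℤ.^ y ≡ (i ℤ.^ N) ℤ.^ x
^-bezout i g M N x y eq = begin
  i ℤ.^ g ℤ.* (i ℤ.^ M) ℤ.^ y   ≡⟨ cong (i ℤ.^ g ℤ.*_) (ℤP.^-*-assoc i M y) ⟩
  i ℤ.^ g ℤ.* i ℤ.^ (M * y)     ≡⟨ ℤP.^-distribˡ-+-* i g (M * y) ⟨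
  i ℤ.^ (g + M * y)             ≡⟨ cong (λ k → i ℤ.^ (g + k)) (ℕP.*-comm M y) ⟩
  i ℤ.^ (g + y * M)             ≡⟨ cong (i ℤ.^_) eq ⟩
  i ℤ.^ (x * N)                 ≡⟨ cong (i ℤ.^_) (ℕP.*-comm x N) ⟩
  i ℤ.^ (N * x)                 ≡⟨ ℤP.^-*-assoc i N x ⟨
  (i ℤ.^ N) ℤ.^ x               ∎
  where open ≡-Reasoning

∣^+1-bezout : ∀ g M N x y → Odd g → Odd N → Odd M → g + y * M ≡ x * N →
              d ∣ a ^ N + 1 → d ∣ a ^ M + 1 → d ∣ a ^ g + 1
∣^+1-bezout {d} {a} g M N x y oddG oddN oddM eq d∣N d∣M = ^≡-1⇒∣^+1 a g (begin
  A ℤ.^ g                                          ≡⟨ ℤP.*-identityʳ (A ℤ.^ g) ⟨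
  A ℤ.^ g ℤ.* 1ℤ                                   ≡⟨ cong (A ℤ.^ g ℤ.*_) (-1^[n+n]≡1 y) ⟨
  A ℤ.^ g ℤ.* -1ℤ ℤ.^ (y + y)                      ≡⟨ cong (A ℤ.^ g ℤ.*_) (ℤP.^-distribˡ-+-* -1ℤ y y) ⟩
  A ℤ.^ g ℤ.* (-1ℤ ℤ.^ y ℤ.* -1ℤ ℤ.^ y)            ≈⟨ *-congˡ-mod (A ℤ.^ g) (*-congʳ-mod (-1ℤ ℤ.^ y)
                                                        (^-cong-mod (≡-mod-sym A^M≡-1) y)) ⟩
  A ℤ.^ g ℤ.* ((A ℤ.^ M) ℤ.^ y ℤ.* -1ℤ ℤ.^ y)      ≡⟨ ℤP.*-assoc (A ℤ.^ g) ((A ℤ.^ M) ℤ.^ y) (-1ℤ ℤ.^ y) ⟨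
  A ℤ.^ g ℤ.* (A ℤ.^ M) ℤ.^ y ℤ.* -1ℤ ℤ.^ y        ≡⟨ cong (ℤ._* -1ℤ ℤ.^ y) (^-bezout A g M N x y eq) ⟩
  (A ℤ.^ N) ℤ.^ x ℤ.* -1ℤ ℤ.^ y                    ≈⟨ *-congʳ-mod (-1ℤ ℤ.^ y) (^-cong-mod A^N≡-1 x) ⟩
  -1ℤ ℤ.^ x ℤ.* -1ℤ ℤ.^ y                          ≡⟨ ℤP.^-distribˡ-+-* -1ℤ x y ⟨
  -1ℤ ℤ.^ (x + y)                                  ≡⟨ -1^odd≡-1 (x + y) (bezout-parity g M N x y oddG oddN oddM eq) ⟩
  -1ℤ                                              ∎)
  where
  open import Relation.Binary.Reasoning.Setoid (≡-mod-setoid d)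
  A = + a
  A^N≡-1 = ∣^+1⇒^≡-1 a N d∣N
  A^M≡-1 = ∣^+1⇒^≡-1 a M d∣M

∣^+1⇒∣^gcd+1 : ∀ a N M → Odd N → Odd M → d ∣ a ^ N + 1 → d ∣ a ^ M + 1 → d ∣ a ^ gcd N M + 1
∣^+1⇒∣^gcd+1 {d} a N M oddN oddM d∣N d∣M = fromBézout (Bézout.identity (gcd-GCD N M))
  where
  oddG : Odd (gcd N M)
  oddG = odd-∣ (gcd[m,n]∣m N M) oddN
  fromBézout : Bézout.Identity (gcd N M) N M → d ∣ a ^ gcd N M + 1
  fromBézout (Bézout.+- x y eq) = ∣^+1-bezout _ M N x y oddG oddN oddM eq d∣N d∣M
  fromBézout (Bézout.-+ x y eq) = ∣^+1-bezout _ N M y x oddG oddM oddN eq d∣M d∣N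

mainTheorem15 : (N M : ℕ) → IsNovak N → IsNovak M → IsNovak (gcd N M) × IsNovak (lcm N M)
mainTheorem15 N M novakN@(_ , N∣2^N+1) novakM@(_ , M∣2^M+1) =
    (odd⇒positive oddGcd , gcd∣2^gcd+1)
  , (odd⇒positive oddLcm , lcm-least (∣2^lcm+1 N N∣2^N+1 (m∣lcm[m,n] N M))
                                     (∣2^lcm+1 M M∣2^M+1 (n∣lcm[m,n] N M)))
  where
  oddN : Odd N
  oddN = novak⇒odd novakN
  oddM : Odd M
  oddM = novak⇒odd novakM
  oddGcd : Odd (gcd N M)
  oddGcd = odd-∣ (gcd[m,n]∣m N M) oddN
  oddLcm : Odd (lcm N M)
  oddLcm = odd-∣ (lcm-least (m∣m*n {N} M) (n∣m*n N {M})) (odd-* {N} {M} oddN oddM)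
  gcd∣2^gcd+1 : gcd N M ∣ 2 ^ gcd N M + 1
  gcd∣2^gcd+1 = ∣^+1⇒∣^gcd+1 2 N M oddN oddM (∣-trans (gcd[m,n]∣m N M) N∣2^N+1)
                                             (∣-trans (gcd[m,n]∣n N M) M∣2^M+1)
  ∣2^lcm+1 : ∀ n → n ∣ 2 ^ n + 1 → n ∣ lcm N M → n ∣ 2 ^ lcm N M + 1
  ∣2^lcm+1 n n∣2^n+1 n∣l = ∣^+1⇒∣^[odd-multiple]+1 2 n n∣2^n+1 n∣l oddLcm
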